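{- Let $S\ge5$ be an odd integer not divisible by $3$, and consider the process with $G^{(0)}=G_S$, thresholds $\alpha=\beta=2$, energy $\mathcal{E}^{(t)}(u,v)=|N_{G^{(t)}}(u)\cap N_{G^{(t)}}(v)|$, and interaction set $C^{(t)}$ consisting of all pairs of distinct vertices at distance at most $2$ in $G^{(t)}$. Then $G^{(t)}$ contains no triangle, for every $t\ge0$.
   Context: $G_S$ is the graph on $\{0,\dots,S-1\}^2$ in which $(x,y)$ is adjacent to $(x,y\pm1\bmod S)$ and $(x\pm1\bmod S,y)$. Process: $G^{(t+1)}$ on the same vertex set is defined by: for each pair $\{u,v\}\in C^{(t)}$, it is an edge of $G^{(t+1)}$ iff $\mathcal{E}^{(t)}(u,v)\ge2$; pairs not in $C^{(t)}$ keep their status. -}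

module Defs where

open import Data.Nat using (ℕ; zero; suc; _+_; _≤_; _≤ᵇ_; _%_)
open import Data.Bool using (Bool; true; false; _∧_; _∨_; not; if_then_else_; T)
open import Data.Fin using (Fin; toℕ)
open import Data.Fin.Properties using () renaming (_≟_ to _≟F_)
open import Data.Product using (_×_; _,_; proj₁; proj₂)
open import Data.List using (List; sum; map; allFin; length; filter)
open import Relation.Nullary.Decidable using (⌊_⌋)
open import Relation.Binary.PropositionalEquality using (_≡_)
open import Relation.Nullary using (¬_)

Vertex : ℕ → Set
Vertex S = Fin S × Fin S

Graph : ℕ → Set
Graph S = Vertex S → Vertex S → Bool

vertices : (S : ℕ) → List (Vertex S)
vertices S = Data.List.concatMap (λ x → map (λ y → (x , y)) (allFin S)) (allFin S)

_==ℕ_ : ℕ → ℕ → Bool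
zero ==ℕ zero = true
zero ==ℕ suc _ = false
suc _ ==ℕ zero = false
suc m ==ℕ suc n = m ==ℕ n

_==F_ : ∀ {S} → Fin S → Fin S → Bool
a ==F b = ⌊ a ≟F b ⌋

_==V_ : ∀ {S} → Vertex S → Vertex S → Bool
(a , b) ==V (c , d) = (a ==F c) ∧ (b ==F d)

-- i and j differ by ±1 modulo S
adjMod : (S : ℕ) → ℕ → ℕ → Bool
adjMod S i j = ((suc i % suc S') ==ℕ j) ∨ ((suc j % suc S') ==ℕ i)
  where
  S' : ℕ
  S' = S Data.Nat.∸ 1

torus : (S : ℕ) → Graph S
torus S (x , y) (x' , y') =
  ((x ==F x') ∧ adjMod S (toℕ y) (toℕ y'))
  ∨ ((y ==F y') ∧ adjMod S (toℕ x) (toℕ x'))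

energy : ∀ {S} → Graph S → Vertex S → Vertex S → ℕ
energy {S} G u v = length (filter (λ w → T? (G u w ∧ G w v)) (vertices S))
  where
  T? : (b : Bool) → Relation.Nullary.Dec (T b)
  T? b = Relation.Nullary.Decidable.T? b

-- Interaction set: distinct u,v at distance ≤ 2 in G
-- (adjacent, or having a common neighbour).
inC : ∀ {S} → Graph S → Vertex S → Vertex S → Bool
inC G u v = not (u ==V v) ∧ (G u v ∨ (1 ≤ᵇ energy G u v))

step : ∀ {S} → Graph S → Graph S
step G u v = if inC G u v then (2 ≤ᵇ energy G u v) else G u v

process : (S : ℕ) → ℕ → Graph S
process S zero = torus S
process S (suc t) = step (process S t)

Edge : ∀ {S} → Graph S → Vertex S → Vertex S → Set
Edge G u v = T (G u v)

HasTriangle : ∀ {S} → Graph S → Set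
HasTriangle {S} G =
  Data.Product.Σ (Vertex S) λ a → Data.Product.Σ (Vertex S) λ b → Data.Product.Σ (Vertex S) λ c →
    ¬ (a ≡ b) × ¬ (b ≡ c) × ¬ (a ≡ c) × Edge G a b × Edge G b c × Edge G a c

module Submission where

-- Call a pair g = (a , b) of integer vectors a *frame*
-- and let  Cay g  be the Cayley graph of ℤ_S² whose edges are the
-- translations by ±a and ±b.  The torus G_S is Cay g₀ for the standard
-- frame g₀ = (e₁ , e₂).  If |det g| is coprime to S, then a coefficient
-- vector (k , l) with |k|, |l| ≤ 4 and  k·a + l·b ≡ 0 (mod S)  is zero
-- (this needs S > 4).  With this "small kernel" property one shows that
-- one step of the process turns Cay g into Cay (next g), where
-- next (a , b) = (a + b , a - b): two vertices have two distinct common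
-- neighbours in Cay g exactly when they differ by ±(a + b) or ±(a - b).
-- Since det (next g) = -2 det g and S is odd, coprimality is preserved,
-- so every G⁽ᵗ⁾ is Cay gₜ for a frame gₜ with small kernel, and a
-- triangle in it would give a nonzero small closed walk u → v → w → u in
-- the square grid with three unit steps, which does not exist.

open import Defs
open import Data.Nat using (ℕ; _≤_; _%_)
open import Relation.Binary.PropositionalEquality using (_≡_)
open import Relation.Nullary using (¬_)

import Data.Nat as ℕ
import Data.Nat.Properties as ℕP
import Data.Nat.Divisibility as ℕD
import Data.Nat.Coprimality as Coprimality
import Data.Nat.DivMod as ℕDM
open import Data.Integer using (ℤ; +_; -[1+_]; ∣_∣; _+_; _*_; _-_; -_; 0ℤ)
import Data.Integer.Properties as ℤP
import Data.Integer.DivMod as ℤD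
open import Data.Integer.Divisibility.Signed
  using (_∣_; divides; ∣m∣n⇒∣m+n; ∣m∣n⇒∣m-n; ∣m⇒∣-m; ∣n⇒∣m*n; ∣⇒∣ᵤ; ∣ᵤ⇒∣)
open import Data.Integer.Tactic.RingSolver using (solve-∀)
open import Data.Fin using (Fin; toℕ; fromℕ<)
import Data.Fin.Properties as FinP
open import Data.Product using (Σ; ∃₂; _×_; _,_; proj₁; proj₂)
open import Data.Product.Properties using (≡-dec)
open import Data.Sum using (_⊎_; inj₁; inj₂)
open import Data.Bool using (true; false; T; not; _∧_; _∨_; if_then_else_)
open import Data.Bool.Properties using (T-∧; T-∨; T-≡)
open import Data.Unit using (tt)
open import Data.Empty using (⊥-elim)
open import Data.List using (List; []; _∷_; _++_; length; filter; map; allFin; cartesianProduct)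
open import Data.List.Membership.Propositional using (_∈_)
open import Data.List.Relation.Unary.Any using (here; there)
open import Data.List.Relation.Unary.All using () renaming (_∷_ to _∷ᴬ_)
open import Data.List.Relation.Unary.AllPairs using () renaming (_∷_ to _∷ᴾ_)
open import Data.List.Relation.Unary.Unique.Propositional using (Unique)
import Data.List.Relation.Unary.Unique.Propositional.Properties as UniqueP
import Data.List.Membership.Propositional.Properties as ∈P
open import Relation.Binary.PropositionalEquality
  using (_≢_; refl; sym; trans; cong; cong₂; subst)
open import Relation.Nullary using (Dec; yes; no)
open import Relation.Nullary.Decidable
  using (T?; map′; from-yes; ¬?; _×-dec_; _⊎-dec_; _→-dec_)
open import Relation.Unary using (Decidable)
open import Function.Bundles using (Equivalence; _⇔_; mk⇔)

∧-intro : ∀ {a b} → T a → T b → T (a ∧ b)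
∧-intro x y = Equivalence.from T-∧ (x , y)

∧-elim : ∀ {a b} → T (a ∧ b) → T a × T b
∧-elim = Equivalence.to T-∧

∨-elim : ∀ {a b} → T (a ∨ b) → T a ⊎ T b
∨-elim = Equivalence.to T-∨

∨-intro : ∀ {a b} → T a ⊎ T b → T (a ∨ b)
∨-intro = Equivalence.from T-∨

module _ {A : Set} {P : A → Set} (P? : Decidable P) where

  two-filtered⇒ : ∀ {xs} → Unique xs → 2 ≤ length (filter P? xs) →
                  ∃₂ λ a b → a ≢ b × P a × P b
  two-filtered⇒ {xs} unique = distinct-pair (filter P? xs) (UniqueP.filter⁺ P? unique)
    (λ m → proj₂ (∈P.∈-filter⁻ P? {xs = xs} m))
    where
    distinct-pair : ∀ ys → Unique ys → (∀ {y} → y ∈ ys → P y) → 2 ≤ length ys →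
                    ∃₂ λ a b → a ≢ b × P a × P b
    distinct-pair (a ∷ b ∷ _) ((a≢b ∷ᴬ _) ∷ᴾ _) all (ℕ.s≤s (ℕ.s≤s _)) =
      a , b , a≢b , all (here refl) , all (there (here refl))

  two-filtered⇐ : ∀ {xs a b} → a ∈ xs → b ∈ xs → a ≢ b → P a → P b →
                  2 ≤ length (filter P? xs)
  two-filtered⇐ a∈ b∈ a≢b pa pb =
    two-members (∈P.∈-filter⁺ P? a∈ pa) (∈P.∈-filter⁺ P? b∈ pb) a≢b
    where
    two-members : ∀ {ys : List A} {a b} → a ∈ ys → b ∈ ys → a ≢ b → 2 ≤ length ys
    two-members {_ ∷ []} (here refl) (here refl) a≢b = ⊥-elim (a≢b refl)
    two-members {_ ∷ _ ∷ _} _ _ _ = ℕ.s≤s (ℕ.s≤s ℕ.z≤n)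

vertices-as-product : ∀ S → vertices S ≡ cartesianProduct (allFin S) (allFin S)
vertices-as-product S = go (allFin S)
  where
  go : (xs : List (Fin S)) →
       Data.List.concatMap (λ x → map (λ y → (x , y)) (allFin S)) xs ≡ cartesianProduct xs (allFin S)
  go [] = refl
  go (x ∷ xs) = cong (map (λ y → (x , y)) (allFin S) ++_) (go xs)

vertices-unique : ∀ S → Unique (vertices S)
vertices-unique S = subst Unique (sym (vertices-as-product S))
  (UniqueP.cartesianProduct⁺ (UniqueP.allFin⁺ S) (UniqueP.allFin⁺ S))

vertices-complete : ∀ S (w : Vertex S) → w ∈ vertices S
vertices-complete S (x , y) = subst ((x , y) ∈_) (sym (vertices-as-product S))
  (∈P.∈-cartesianProduct⁺ (∈P.∈-allFin x) (∈P.∈-allFin y))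

TwoCommon : ∀ {S} → Graph S → Vertex S → Vertex S → Set
TwoCommon {S} G u v =
  ∃₂ λ (w w′ : Vertex S) → w ≢ w′ × T (G u w ∧ G w v) × T (G u w′ ∧ G w′ v)

energy≥2⇔TwoCommon : ∀ {S} (G : Graph S) u v → 2 ≤ energy G u v ⇔ TwoCommon G u v
energy≥2⇔TwoCommon {S} G u v = mk⇔
  (two-filtered⇒ common? (vertices-unique S))
  (λ (w , w′ , w≢w′ , cw , cw′) →
     two-filtered⇐ common? (vertices-complete S w) (vertices-complete S w′) w≢w′ cw cw′)
  where
  common? : Decidable (λ w → T (G u w ∧ G w v))
  common? w = T? (G u w ∧ G w v)

==F-sound : ∀ {S} {a b : Fin S} → T (a ==F b) → a ≡ b
==F-sound {a = a} {b} h with a FinP.≟ b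
... | yes a≡b = a≡b

==F-refl : ∀ {S} (a : Fin S) → T (a ==F a)
==F-refl a with a FinP.≟ a
... | yes _ = tt
... | no a≢a = a≢a refl

==V-false : ∀ {S} {u v : Vertex S} → u ≢ v → (u ==V v) ≡ false
==V-false {u = a , b} {c , d} u≢v with (a , b) ==V (c , d) in eq
... | false = refl
... | true with ∧-elim {a ==F c} (subst T (sym eq) tt)
...   | a=c , b=d = ⊥-elim (u≢v (cong₂ _,_ (==F-sound a=c) (==F-sound b=d)))

==V-true : ∀ {S} (u : Vertex S) → (u ==V u) ≡ true
==V-true (a , b) = Equivalence.to T-≡ (∧-intro {a ==F a} (==F-refl a) (==F-refl b))

-- The step rule: loops are never in C, so they are kept; between
-- distinct vertices the new edge set is exactly "energy ≥ 2", because
-- energy ≥ 2 already places the pair in C.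
step-diagonal : ∀ {S} (G : Graph S) u → step G u u ≡ G u u
step-diagonal G u = keep (u ==V u) (==V-true u)
  where
  keep : ∀ {x y} b → b ≡ true → (if not b ∧ x then y else G u u) ≡ G u u
  keep true refl = refl

step-offDiagonal : ∀ {S} (G : Graph S) {u v} → u ≢ v → step G u v ≡ (2 ℕ.≤ᵇ energy G u v)
step-offDiagonal G {u} {v} u≢v = decide (u ==V v) (G u v) (energy G u v) (==V-false u≢v)
  where
  decide : ∀ b g e → b ≡ false →
           (if not b ∧ (g ∨ (1 ℕ.≤ᵇ e)) then 2 ℕ.≤ᵇ e else g) ≡ (2 ℕ.≤ᵇ e)
  decide false true e refl = refl
  decide false false ℕ.zero refl = refl
  decide false false (ℕ.suc e) refl = refl

step⇔TwoCommon : ∀ {S} (G : Graph S) {u v} → u ≢ v → T (step G u v) ⇔ TwoCommon G u v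
step⇔TwoCommon G {u} {v} u≢v = mk⇔
  (λ h → Equivalence.to (energy≥2⇔TwoCommon G u v)
           (ℕP.≤ᵇ⇒≤ 2 _ (subst T (step-offDiagonal G u≢v) h)))
  (λ two → subst T (sym (step-offDiagonal G u≢v))
             (ℕP.≤⇒≤ᵇ (Equivalence.from (energy≥2⇔TwoCommon G u v) two)))

V2 : Set
V2 = ℤ × ℤ

𝟎 : V2
𝟎 = 0ℤ , 0ℤ

infixl 6 _⊕_ _⊝_

_⊕_ : V2 → V2 → V2
(a , b) ⊕ (c , d) = a + c , b + d

_⊝_ : V2 → V2 → V2
(a , b) ⊝ (c , d) = a - c , b - d

infix 4 _≟V_
_≟V_ : (p q : V2) → Dec (p ≡ q)
_≟V_ = ≡-dec ℤP._≟_ ℤP._≟_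

data Dir : Set where
  east west north south : Dir

unit : Dir → V2
unit east  = + 1 , 0ℤ
unit west  = -[1+ 0 ] , 0ℤ
unit north = 0ℤ , + 1
unit south = 0ℤ , -[1+ 0 ]

mix : V2 → V2
mix (k , l) = k + l , k - l

Small : V2 → Set
Small (k , l) = ∣ k ∣ ≤ 4 × ∣ l ∣ ≤ 4

small? : Decidable Small
small? (k , l) = ∣ k ∣ ℕ.≤? 4 ×-dec ∣ l ∣ ℕ.≤? 4

every? : {P : Dir → Set} → Decidable P → Dec (∀ d → P d)
every? {P} P? = map′ from to (P? east ×-dec P? west ×-dec P? north ×-dec P? south)
  where
  from : P east × P west × P north × P south → ∀ d → P d
  from (e , _ , _ , _) east = e
  from (_ , w , _ , _) west = w
  from (_ , _ , n , _) north = n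
  from (_ , _ , _ , s) south = s
  to : (∀ d → P d) → P east × P west × P north × P south
  to f = f east , f west , f north , f south

some? : {P : Dir → Set} → Decidable P → Dec (Σ Dir P)
some? {P} P? = map′ from to (P? east ⊎-dec P? west ⊎-dec P? north ⊎-dec P? south)
  where
  from : P east ⊎ P west ⊎ P north ⊎ P south → Σ Dir P
  from (inj₁ e) = east , e
  from (inj₂ (inj₁ w)) = west , w
  from (inj₂ (inj₂ (inj₁ n))) = north , n
  from (inj₂ (inj₂ (inj₂ s))) = south , s
  to : Σ Dir P → P east ⊎ P west ⊎ P north ⊎ P south
  to (east , e) = inj₁ e
  to (west , w) = inj₂ (inj₁ w)
  to (north , n) = inj₂ (inj₂ (inj₁ n))
  to (south , s) = inj₂ (inj₂ (inj₂ s))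

-- A single unit step is a small nonzero displacement (no loops); it is
-- compared with the empty route, hence the form unit d ⊝ 𝟎.
unit-nonzero : ∀ d → Small (unit d ⊝ 𝟎) × unit d ⊝ 𝟎 ≢ 𝟎
unit-nonzero = from-yes (every? λ d → small? (unit d ⊝ 𝟎) ×-dec ¬? (unit d ⊝ 𝟎 ≟V 𝟎))

-- Three unit steps never close up (each step flips the parity of the
-- coordinate sum), and their net displacement is small (no triangles).
three-steps-nonzero : ∀ d₁ d₂ d₃ →
  Small (unit d₁ ⊕ unit d₂ ⊝ unit d₃) × unit d₁ ⊕ unit d₂ ⊝ unit d₃ ≢ 𝟎
three-steps-nonzero = from-yes (every? λ d₁ → every? λ d₂ → every? λ d₃ →
  small? (unit d₁ ⊕ unit d₂ ⊝ unit d₃) ×-dec ¬? (unit d₁ ⊕ unit d₂ ⊝ unit d₃ ≟V 𝟎))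

two-step-difference-small : ∀ d₁ d₂ d₃ d₄ → Small ((unit d₁ ⊕ unit d₂) ⊝ (unit d₃ ⊕ unit d₄))
two-step-difference-small = from-yes (every? λ d₁ → every? λ d₂ → every? λ d₃ → every? λ d₄ →
  small? ((unit d₁ ⊕ unit d₂) ⊝ (unit d₃ ⊕ unit d₄)))

two-routes⇒diagonal : ∀ d₁ d₂ d₃ d₄ →
  (unit d₁ ⊕ unit d₂) ⊝ (unit d₃ ⊕ unit d₄) ≡ 𝟎 → unit d₁ ≢ unit d₃ →
  unit d₁ ⊕ unit d₂ ≢ 𝟎 → Σ Dir λ d → mix (unit d) ≡ unit d₁ ⊕ unit d₂
two-routes⇒diagonal = from-yes (every? λ d₁ → every? λ d₂ → every? λ d₃ → every? λ d₄ →
  ((unit d₁ ⊕ unit d₂) ⊝ (unit d₃ ⊕ unit d₄) ≟V 𝟎) →-dec ¬? (unit d₁ ≟V unit d₃) →-dec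
  ¬? (unit d₁ ⊕ unit d₂ ≟V 𝟎) →-dec some? λ d → mix (unit d) ≟V unit d₁ ⊕ unit d₂)

diagonal⇒two-routes : ∀ d → Σ Dir λ d₁ → Σ Dir λ d₃ →
  unit d₁ ⊕ unit d₃ ≡ mix (unit d) × unit d₃ ⊕ unit d₁ ≡ mix (unit d) ×
  Small (unit d₁ ⊝ unit d₃) × unit d₁ ⊝ unit d₃ ≢ 𝟎
diagonal⇒two-routes east  = east , north , refl , refl , (ℕ.s≤s ℕ.z≤n , ℕ.s≤s ℕ.z≤n) , λ ()
diagonal⇒two-routes west  = west , south , refl , refl , (ℕ.s≤s ℕ.z≤n , ℕ.s≤s ℕ.z≤n) , λ ()
diagonal⇒two-routes north = east , south , refl , refl , (ℕ.s≤s ℕ.z≤n , ℕ.s≤s ℕ.z≤n) , λ ()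
diagonal⇒two-routes south = west , north , refl , refl , (ℕ.s≤s ℕ.z≤n , ℕ.s≤s ℕ.z≤n) , λ ()

Frame : Set
Frame = V2 × V2

lin : Frame → V2 → V2
lin ((a , b) , (c , d)) (k , l) = k * a + l * c , k * b + l * d

next : Frame → Frame
next ((a , b) , (c , d)) = (a + c , b + d) , (a - c , b - d)

det : Frame → ℤ
det ((a , b) , (c , d)) = a * d - b * c

standard-frame : Frame
standard-frame = (+ 1 , 0ℤ) , (0ℤ , + 1)

lin-⊕ : ∀ g p q → lin g (p ⊕ q) ≡ lin g p ⊕ lin g q
lin-⊕ ((a , b) , (c , d)) (k , l) (k′ , l′) = cong₂ _,_ (law k l k′ l′ a c) (law k l k′ l′ b d)
  where
  law : ∀ k l k′ l′ x y → (k + k′) * x + (l + l′) * y ≡ (k * x + l * y) + (k′ * x + l′ * y)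
  law = solve-∀

lin-⊝ : ∀ g p q → lin g (p ⊝ q) ≡ lin g p ⊝ lin g q
lin-⊝ ((a , b) , (c , d)) (k , l) (k′ , l′) = cong₂ _,_ (law k l k′ l′ a c) (law k l k′ l′ b d)
  where
  law : ∀ k l k′ l′ x y → (k - k′) * x + (l - l′) * y ≡ (k * x + l * y) - (k′ * x + l′ * y)
  law = solve-∀

lin-next : ∀ g p → lin (next g) p ≡ lin g (mix p)
lin-next ((a , b) , (c , d)) (k , l) = cong₂ _,_ (law k l a c) (law k l b d)
  where
  law : ∀ k l x y → k * (x + y) + l * (x - y) ≡ (k + l) * x + (k - l) * y
  law = solve-∀

det-next : ∀ g → det (next g) ≡ - (+ 2 * det g)
det-next ((a , b) , (c , d)) = law a b c d
  where
  law : ∀ a b c d → (a + c) * (b - d) - (b + d) * (a - c) ≡ - (+ 2 * (a * d - b * c))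
  law = solve-∀

module Torus (n : ℕ) (4<S : 4 ℕ.< ℕ.suc n) (S-odd : ℕ.suc n % 2 ≡ 1) where

  S : ℕ
  S = ℕ.suc n

  Vtx : Set
  Vtx = Vertex S

  Null : ℤ → Set
  Null z = + S ∣ z

  Null² : V2 → Set
  Null² (k , l) = Null k × Null l

  null-sum : ∀ {x y z} → Null x → Null y → z ≡ x + y → Null z
  null-sum nx ny eq = subst Null (sym eq) (∣m∣n⇒∣m+n nx ny)

  null-difference : ∀ {x y z} → Null x → Null y → z ≡ x - y → Null z
  null-difference nx ny eq = subst Null (sym eq) (∣m∣n⇒∣m-n nx ny)

  null-below-S : ∀ {z} → Null z → ∣ z ∣ ℕ.< S → z ≡ 0ℤ
  null-below-S {z} nz z<S with ∣ z ∣ in eq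
  ... | ℕ.zero = ℤP.∣i∣≡0⇒i≡0 eq
  ... | ℕ.suc m = ⊥-elim (ℕP.<⇒≱ z<S (ℕD.∣⇒≤ (subst (S ℕD.∣_) eq (∣⇒∣ᵤ nz))))

  residue-unique : ∀ {i j} → i ℕ.< S → j ℕ.< S → Null (+ i - + j) → i ≡ j
  residue-unique {i} {j} i<S j<S h =
    ℤP.+-injective (ℤP.i-j≡0⇒i≡j (+ i) (+ j) (null-below-S h difference<S))
    where
    difference<S : ∣ + i - + j ∣ ℕ.< S
    difference<S = subst (ℕ._< S) (sym (cong ∣_∣ (ℤP.m-n≡m⊖n i j)))
      (ℕP.≤-<-trans (ℤP.∣m⊝n∣≤m⊔n i j) (ℕP.⊔-lub i<S j<S))

  remainder-congruent : ∀ z → Null (+ (z ℤD.%ℕ S) - z)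
  remainder-congruent z =
    subst (λ w → Null (+ (z ℤD.%ℕ S) - w)) (sym (ℤD.a≡a%ℕn+[a/ℕn]*n z S))
      (divides (- (z ℤD./ℕ S)) (law (+ (z ℤD.%ℕ S)) (z ℤD./ℕ S) (+ S)))
    where
    law : ∀ r q s → r - (r + q * s) ≡ (- q) * s
    law = solve-∀

  remainder⇔ : ∀ m {j} → j ℕ.< S → (m % S ≡ j) ⇔ Null (+ j - + m)
  remainder⇔ m {j} j<S = mk⇔
    (λ { refl → remainder-congruent (+ m) })
    (λ h → sym (residue-unique j<S (ℕDM.m%n<n m S)
                  (null-difference h (remainder-congruent (+ m)) (law (+ j) (+ (m % S)) (+ m)))))
    where
    law : ∀ a b c → a - b ≡ (a - c) - (b - c)
    law = solve-∀

  ι : Fin S → ℤ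
  ι x = + toℕ x

  ι-injective : ∀ {x y} → Null (ι x - ι y) → x ≡ y
  ι-injective {x} {y} h = FinP.toℕ-injective (residue-unique (FinP.toℕ<n x) (FinP.toℕ<n y) h)

  residue : (z : ℤ) → Σ (Fin S) λ x → Null (ι x - z)
  residue z = fromℕ< (ℤD.n%ℕd<d z S) ,
    subst (λ r → Null (+ r - z)) (sym (FinP.toℕ-fromℕ< (ℤD.n%ℕd<d z S))) (remainder-congruent z)

  Shift : Fin S → Fin S → ℤ → Set
  Shift x x′ e = Null (ι x′ - (e + ι x))

  shift-zero : ∀ x → Shift x x 0ℤ
  shift-zero x = divides 0ℤ (law (ι x))
    where
    law : ∀ z → z - (0ℤ + z) ≡ 0ℤ * + S
    law = solve-∀

  record Step (u v : Vtx) (e : V2) : Set where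
    constructor shifts
    field
      shift-x : Shift (proj₁ u) (proj₁ v) (proj₁ e)
      shift-y : Shift (proj₂ u) (proj₂ v) (proj₂ e)

  step-compose : ∀ {u w v e f} → Step u w e → Step w v f → Step u v (e ⊕ f)
  step-compose {ux , uy} {wx , wy} {vx , vy} {e , e′} {f , f′} (shifts a b) (shifts c d) =
    shifts (null-sum c a (law (ι ux) (ι wx) (ι vx) e f)) (null-sum d b (law (ι uy) (ι wy) (ι vy) e′ f′))
    where
    law : ∀ x x′ x″ e f → x″ - ((e + f) + x) ≡ (x″ - (f + x′)) + (x′ - (e + x))
    law = solve-∀

  step-cancel : ∀ {u w v e f} → Step u w e → Step u v (e ⊕ f) → Step w v f
  step-cancel {ux , uy} {wx , wy} {vx , vy} {e , e′} {f , f′} (shifts a b) (shifts c d) =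
    shifts (null-difference c a (law (ι ux) (ι wx) (ι vx) e f))
           (null-difference d b (law (ι uy) (ι wy) (ι vy) e′ f′))
    where
    law : ∀ x x′ x″ e f → x″ - (f + x′) ≡ (x″ - ((e + f) + x)) - (x′ - (e + x))
    law = solve-∀

  step-difference : ∀ {u w e f} → Step u w e → Step u w f → Null² (e ⊝ f)
  step-difference {ux , uy} {wx , wy} {e , e′} {f , f′} (shifts a b) (shifts c d) =
    null-difference c a (law (ι ux) (ι wx) e f) , null-difference d b (law (ι uy) (ι wy) e′ f′)
    where
    law : ∀ x x′ e f → e - f ≡ (x′ - (f + x)) - (x′ - (e + x))
    law = solve-∀

  step-functional : ∀ {u w w′ e} → Step u w e → Step u w′ e → w ≡ w′
  step-functional {ux , uy} {x , y} {x′ , y′} {e , f} (shifts a b) (shifts c d) =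
    cong₂ _,_ (ι-injective (null-difference a c (law (ι x) (ι x′) (e + ι ux))))
              (ι-injective (null-difference b d (law (ι y) (ι y′) (f + ι uy))))
    where
    law : ∀ a b c → a - b ≡ (a - c) - (b - c)
    law = solve-∀

  step-refl : ∀ u → Step u u 𝟎
  step-refl (x , y) = shifts (shift-zero x) (shift-zero y)

  step-exists : ∀ u e → Σ Vtx λ v → Step u v e
  step-exists (x , y) (e , f) with residue (e + ι x) | residue (f + ι y)
  ... | x′ , a | y′ , b = (x′ , y′) , shifts a b

  record Cay (g : Frame) (u v : Vtx) : Set where
    constructor edge
    field
      direction   : Dir
      translation : Step u v (lin g (unit direction))

  ==ℕ-sound : ∀ {a b} → T (a ==ℕ b) → a ≡ b
  ==ℕ-sound {ℕ.zero} {ℕ.zero} _ = refl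
  ==ℕ-sound {ℕ.suc a} {ℕ.suc b} h = cong ℕ.suc (==ℕ-sound h)

  ==ℕ-refl : ∀ a → T (a ==ℕ a)
  ==ℕ-refl ℕ.zero = tt
  ==ℕ-refl (ℕ.suc a) = ==ℕ-refl a

  same⇔ : ∀ x x′ → T (x ==F x′) ⇔ Shift x x′ 0ℤ
  same⇔ x x′ = mk⇔
    (λ h → subst (λ z → Shift x z 0ℤ) (==F-sound h) (shift-zero x))
    (λ h → subst (λ z → T (x ==F z))
             (sym (ι-injective (null-difference h (shift-zero x) (law (ι x′) (ι x))))) (==F-refl x))
    where
    law : ∀ a b → a - b ≡ (a - (0ℤ + b)) - (b - (0ℤ + b))
    law = solve-∀

  adjacent⇔ : ∀ x x′ → T (adjMod S (toℕ x) (toℕ x′)) ⇔ (Shift x x′ (+ 1) ⊎ Shift x x′ -[1+ 0 ])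
  adjacent⇔ x x′ = mk⇔ to from
    where
    i j : ℕ
    i = toℕ x
    j = toℕ x′
    law : ∀ a b → b - (-[1+ 0 ] + a) ≡ - (a - (+ 1 + b))
    law = solve-∀
    to : T (adjMod S i j) → Shift x x′ (+ 1) ⊎ Shift x x′ -[1+ 0 ]
    to h with ∨-elim {(ℕ.suc i % S) ==ℕ j} h
    ... | inj₁ up   = inj₁ (Equivalence.to (remainder⇔ (ℕ.suc i) (FinP.toℕ<n x′)) (==ℕ-sound up))
    ... | inj₂ down = inj₂ (subst Null (sym (law (ι x) (ι x′)))
                              (∣m⇒∣-m (Equivalence.to (remainder⇔ (ℕ.suc j) (FinP.toℕ<n x)) (==ℕ-sound down))))
    from : Shift x x′ (+ 1) ⊎ Shift x x′ -[1+ 0 ] → T (adjMod S i j)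
    from (inj₁ up) = ∨-intro {(ℕ.suc i % S) ==ℕ j} (inj₁
      (subst (λ r → T (r ==ℕ j))
        (sym (Equivalence.from (remainder⇔ (ℕ.suc i) (FinP.toℕ<n x′)) up)) (==ℕ-refl j)))
    from (inj₂ down) = ∨-intro {(ℕ.suc i % S) ==ℕ j} (inj₂
      (subst (λ r → T (r ==ℕ i))
        (sym (Equivalence.from (remainder⇔ (ℕ.suc j) (FinP.toℕ<n x)) down′)) (==ℕ-refl i)))
      where
      down′ : Null (ι x - (+ 1 + ι x′))
      down′ = subst Null (ℤP.neg-involutive _) (∣m⇒∣-m (subst Null (law (ι x) (ι x′)) down))

  torus⇔Cay : ∀ u v → T (torus S u v) ⇔ Cay standard-frame u v
  torus⇔Cay (x , y) (x′ , y′) = mk⇔ to from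
    where
    to : T (torus S (x , y) (x′ , y′)) → Cay standard-frame (x , y) (x′ , y′)
    to h with ∨-elim {(x ==F x′) ∧ adjMod S (toℕ y) (toℕ y′)} h
    ... | inj₁ vertical with ∧-elim {x ==F x′} vertical
    ...   | same , adj with Equivalence.to (adjacent⇔ y y′) adj
    ...     | inj₁ up   = edge north (shifts (Equivalence.to (same⇔ x x′) same) up)
    ...     | inj₂ down = edge south (shifts (Equivalence.to (same⇔ x x′) same) down)
    to h | inj₂ horizontal with ∧-elim {y ==F y′} horizontal
    ...   | same , adj with Equivalence.to (adjacent⇔ x x′) adj
    ...     | inj₁ up   = edge east (shifts up (Equivalence.to (same⇔ y y′) same))
    ...     | inj₂ down = edge west (shifts down (Equivalence.to (same⇔ y y′) same))
    vertical : Shift x x′ 0ℤ → Shift y y′ (+ 1) ⊎ Shift y y′ -[1+ 0 ] → T (torus S (x , y) (x′ , y′))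
    vertical same adj = ∨-intro {(x ==F x′) ∧ adjMod S (toℕ y) (toℕ y′)}
      (inj₁ (∧-intro {x ==F x′} (Equivalence.from (same⇔ x x′) same) (Equivalence.from (adjacent⇔ y y′) adj)))
    horizontal : Shift y y′ 0ℤ → Shift x x′ (+ 1) ⊎ Shift x x′ -[1+ 0 ] → T (torus S (x , y) (x′ , y′))
    horizontal same adj = ∨-intro {(x ==F x′) ∧ adjMod S (toℕ y) (toℕ y′)}
      (inj₂ (∧-intro {y ==F y′} (Equivalence.from (same⇔ y y′) same) (Equivalence.from (adjacent⇔ x x′) adj)))
    from : Cay standard-frame (x , y) (x′ , y′) → T (torus S (x , y) (x′ , y′))
    from (edge east  (shifts a b)) = horizontal b (inj₁ a)
    from (edge west  (shifts a b)) = horizontal b (inj₂ a)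
    from (edge north (shifts a b)) = vertical a (inj₁ b)
    from (edge south (shifts a b)) = vertical a (inj₂ b)

  Good : Frame → Set
  Good g = Coprimality.Coprime S ∣ det g ∣

  -- From k·a + l·b ≡ 0 one gets k·det ≡ 0 and
  -- l·det ≡ 0, hence S ∣ k and S ∣ l, and |k|, |l| ≤ 4 < S.
  small-kernel : ∀ g → Good g → ∀ p → Small p → Null² (lin g p) → p ≡ 𝟎
  small-kernel ((a , b) , (c , d)) good (k , l) (k≤4 , l≤4) (h₁ , h₂) =
    cong₂ _,_ (annihilated k≤4 k-det) (annihilated l≤4 l-det)
    where
    Δ : ℤ
    Δ = a * d - b * c
    annihilated : ∀ {x} → ∣ x ∣ ≤ 4 → Null (x * Δ) → x ≡ 0ℤ
    annihilated {x} x≤4 nx = null-below-S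
      (∣ᵤ⇒∣ (Coprimality.coprime-divisor good
        (subst (S ℕD.∣_) (trans (ℤP.abs-* x Δ) (ℕP.*-comm ∣ x ∣ ∣ Δ ∣)) (∣⇒∣ᵤ nx))))
      (ℕP.≤-<-trans x≤4 4<S)
    k-det : Null (k * Δ)
    k-det = null-difference (∣n⇒∣m*n d h₁) (∣n⇒∣m*n c h₂) (law a b c d k l)
      where
      law : ∀ a b c d k l → k * (a * d - b * c) ≡ d * (k * a + l * c) - c * (k * b + l * d)
      law = solve-∀
    l-det : Null (l * Δ)
    l-det = null-difference (∣n⇒∣m*n a h₂) (∣n⇒∣m*n b h₁) (law a b c d k l)
      where
      law : ∀ a b c d k l → l * (a * d - b * c) ≡ a * (k * b + l * d) - b * (k * a + l * c)
      law = solve-∀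

  -- Goodness is preserved by next, because S is odd.
  good-next : ∀ g → Good g → Good (next g)
  good-next g good = subst (Coprimality.Coprime S) (sym ∣det-next∣) (coprime-2* good)
    where
    ∣det-next∣ : ∣ det (next g) ∣ ≡ 2 ℕ.* ∣ det g ∣
    ∣det-next∣ = trans (cong ∣_∣ (det-next g))
      (trans (ℤP.∣-i∣≡∣i∣ (+ 2 * det g)) (ℤP.abs-* (+ 2) (det g)))
    coprime-2 : Coprimality.Coprime S 2
    coprime-2 {i} (i∣S , i∣2) with ℕD.∣⇒≤ i∣2
    coprime-2 {ℕ.zero} (_ , i∣2) | _ with ℕD.0∣⇒≡0 i∣2
    ... | ()
    coprime-2 {ℕ.suc ℕ.zero} _ | _ = refl
    coprime-2 {ℕ.suc (ℕ.suc ℕ.zero)} (i∣S , _) | _ with trans (sym S-odd) (ℕD.n∣m⇒m%n≡0 S 2 i∣S)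
    ... | ()
    coprime-2 {ℕ.suc (ℕ.suc (ℕ.suc i))} _ | ℕ.s≤s (ℕ.s≤s ())
    coprime-2* : ∀ {m} → Coprimality.Coprime S m → Coprimality.Coprime S (2 ℕ.* m)
    coprime-2* cm {i} (i∣S , i∣2m) = cm (i∣S , Coprimality.coprime-divisor i⊥2 i∣2m)
      where
      i⊥2 : Coprimality.Coprime i 2
      i⊥2 (j∣i , j∣2) = coprime-2 (ℕD.∣-trans j∣i i∣S , j∣2)

  good-standard : Good standard-frame
  good-standard = Coprimality.sym (Coprimality.1-coprimeTo S)

  routes-agree : ∀ {u v} g p q → Good g → Small (p ⊝ q) →
                 Step u v (lin g p) → Step u v (lin g q) → p ⊝ q ≡ 𝟎
  routes-agree g p q good small sp sq =
    small-kernel g good (p ⊝ q) small (subst Null² (sym (lin-⊝ g p q)) (step-difference sp sq))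

  compose : ∀ {u w v} g p q → Step u w (lin g p) → Step w v (lin g q) → Step u v (lin g (p ⊕ q))
  compose {u} {v = v} g p q s t = subst (Step u v) (sym (lin-⊕ g p q)) (step-compose s t)

  cay-loopless : ∀ {g u v} → Good g → Cay g u v → u ≢ v
  cay-loopless {g} {u} good (edge d s) refl =
    proj₂ (unit-nonzero d) (routes-agree g (unit d) 𝟎 good (proj₁ (unit-nonzero d)) s (step-refl u))

  cay-triangle-free : ∀ {g a b c} → Good g → Cay g a b → Cay g b c → ¬ Cay g a c
  cay-triangle-free {g} good (edge d₁ s₁) (edge d₂ s₂) (edge d₃ s₃) =
    proj₂ (three-steps-nonzero d₁ d₂ d₃)
      (routes-agree g (unit d₁ ⊕ unit d₂) (unit d₃) good (proj₁ (three-steps-nonzero d₁ d₂ d₃))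
        (compose g (unit d₁) (unit d₂) s₁ s₂) s₃)

  -- Two distinct vertices with two distinct common neighbours in Cay g
  -- are adjacent in Cay (next g): the two routes have the same small
  -- displacement, start differently and do not cancel, hence are diagonal.
  two-common⇒next : ∀ g {u v w w′} → Good g → u ≢ v → w ≢ w′ →
    Cay g u w → Cay g w v → Cay g u w′ → Cay g w′ v → Cay (next g) u v
  two-common⇒next g {u} {v} {w} {w′} good u≢v w≢w′
                  (edge d₁ s₁) (edge d₂ s₂) (edge d₃ s₃) (edge d₄ s₄) =
    diagonal-edge (two-routes⇒diagonal d₁ d₂ d₃ d₄ same-displacement different-start nonzero)
    where
    route : Step u v (lin g (unit d₁ ⊕ unit d₂))
    route = compose g (unit d₁) (unit d₂) s₁ s₂
    same-displacement : (unit d₁ ⊕ unit d₂) ⊝ (unit d₃ ⊕ unit d₄) ≡ 𝟎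
    same-displacement = routes-agree g (unit d₁ ⊕ unit d₂) (unit d₃ ⊕ unit d₄) good
      (two-step-difference-small d₁ d₂ d₃ d₄) route (compose g (unit d₃) (unit d₄) s₃ s₄)
    different-start : unit d₁ ≢ unit d₃
    different-start eq = w≢w′ (step-functional s₁ (subst (λ e → Step u w′ (lin g e)) (sym eq) s₃))
    nonzero : unit d₁ ⊕ unit d₂ ≢ 𝟎
    nonzero eq = u≢v (step-functional (step-refl u) (subst (λ e → Step u v (lin g e)) eq route))
    diagonal-edge : Σ Dir (λ d → mix (unit d) ≡ unit d₁ ⊕ unit d₂) → Cay (next g) u v
    diagonal-edge (d , diagonal) =
      edge d (subst (Step u v) (sym (trans (lin-next g (unit d)) (cong (lin g) diagonal))) route)

  next⇒two-common : ∀ g {u v} → Good g → Cay (next g) u v →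
    ∃₂ λ w w′ → w ≢ w′ × Cay g u w × Cay g w v × Cay g u w′ × Cay g w′ v
  next⇒two-common g {u} {v} good (edge d s) with diagonal⇒two-routes d
  ... | d₁ , d₃ , e₁₃ , e₃₁ , small , nonzero =
    w , w′ , w≢w′ , edge d₁ t , edge d₃ (step-cancel t (via {unit d₁} e₁₃)) ,
    edge d₃ t′ , edge d₁ (step-cancel t′ (via {unit d₃} e₃₁))
    where
    via : ∀ {p q} → p ⊕ q ≡ mix (unit d) → Step u v (lin g p ⊕ lin g q)
    via {p} {q} eq =
      subst (Step u v) (trans (lin-next g (unit d)) (trans (cong (lin g) (sym eq)) (lin-⊕ g p q))) s
    w w′ : Vtx
    w = proj₁ (step-exists u (lin g (unit d₁)))
    w′ = proj₁ (step-exists u (lin g (unit d₃)))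
    t : Step u w (lin g (unit d₁))
    t = proj₂ (step-exists u (lin g (unit d₁)))
    t′ : Step u w′ (lin g (unit d₃))
    t′ = proj₂ (step-exists u (lin g (unit d₃)))
    w≢w′ : w ≢ w′
    w≢w′ eq = nonzero (routes-agree g (unit d₁) (unit d₃) good small t
                         (subst (λ z → Step u z (lin g (unit d₃))) (sym eq) t′))

  Presents : Graph S → Frame → Set
  Presents G g = Good g × (∀ u v → T (G u v) ⇔ Cay g u v)

  presents-step : ∀ {G g} → Presents G g → Presents (step G) (next g)
  presents-step {G} {g} (good , edges) = good-next g good , λ u v → mk⇔ (to u v) (from u v)
    where
    edge⇒ : ∀ {u v} → T (G u v) → Cay g u v
    edge⇒ {u} {v} = Equivalence.to (edges u v)
    ⇒edge : ∀ {u v} → Cay g u v → T (G u v)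
    ⇒edge {u} {v} = Equivalence.from (edges u v)
    to : ∀ u v → T (step G u v) → Cay (next g) u v
    to u v h with ≡-dec FinP._≟_ FinP._≟_ u v
    ... | yes refl = ⊥-elim (cay-loopless good (edge⇒ (subst T (step-diagonal G u) h)) refl)
    ... | no u≢v with Equivalence.to (step⇔TwoCommon G u≢v) h
    ...   | w , w′ , w≢w′ , c , c′ = two-common⇒next g good u≢v w≢w′
            (edge⇒ (proj₁ (∧-elim {G u w} {G w v} c)))
            (edge⇒ (proj₂ (∧-elim {G u w} {G w v} c)))
            (edge⇒ (proj₁ (∧-elim {G u w′} {G w′ v} c′)))
            (edge⇒ (proj₂ (∧-elim {G u w′} {G w′ v} c′)))
    from : ∀ u v → Cay (next g) u v → T (step G u v)
    from u v e = Equivalence.from (step⇔TwoCommon G (cay-loopless {next g} (good-next g good) e))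
                   (as-TwoCommon (next⇒two-common g good e))
      where
      as-TwoCommon : (∃₂ λ w w′ → w ≢ w′ × Cay g u w × Cay g w v × Cay g u w′ × Cay g w′ v) →
                     TwoCommon G u v
      as-TwoCommon (w , w′ , w≢w′ , uw , wv , uw′ , w′v) =
        w , w′ , w≢w′ , ∧-intro {G u w} {G w v} (⇒edge uw) (⇒edge wv) ,
                        ∧-intro {G u w′} {G w′ v} (⇒edge uw′) (⇒edge w′v)

  process-presents : ∀ t → Σ Frame (Presents (process S t))
  process-presents ℕ.zero = standard-frame , good-standard , torus⇔Cay
  process-presents (ℕ.suc t) with process-presents t
  ... | g , presents = next g , presents-step presents

  presents⇒triangle-free : ∀ {G g} → Presents G g → ¬ HasTriangle G
  presents⇒triangle-free (good , edges) (a , b , c , _ , _ , _ , ab , bc , ac) =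
    cay-triangle-free good (Equivalence.to (edges a b) ab) (Equivalence.to (edges b c) bc)
      (Equivalence.to (edges a c) ac)

lemma10 : (S : ℕ) → 5 ≤ S → S % 2 ≡ 1 → ¬ (S % 3 ≡ 0) →
    (t : ℕ) → ¬ HasTriangle (process S t)
lemma10 (ℕ.suc n) 5≤S S-odd _ t = presents⇒triangle-free (proj₂ (process-presents t))
  where open Torus n 5≤S S-odd
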